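{- Starting from the empty quadtree configuration (no assigned squares), for every valid, aligned sequence of requests $\sigma_1,\ldots,\sigma_k$ there is a strategy that fulfills every request of the sequence in order.
   Context: The unit square $[0,1]^2$ is recursively subdivided as a quadtree of unbounded depth: the root (layer $0$) is $[0,1]^2$, and every node (pixel) of layer $j$ is an axis-parallel square of side $2^{ -j}$ whose four children are its four quadrants. A pixel of layer $j$ is a $j$-pixel. For $r\in\mathbb{N}_0$, an $r$-square is an axis-parallel square of side $2^{ -r}$. A (quadtree) configuration assigns finitely many squares to pixels, each $j$-square to a $j$-pixel, at most one square per pixel, such that no pixel with an assigned square is a proper descendant of another pixel with an assigned square. A pixel contains a square if it is assigned to it or to a descendant. A pixel with an assigned square is occupied; a non-occupied pixel is blocked if some ancestor is occupied, free otherwise; a free pixel is empty if it contains no square. A move takes a $j$-square assigned to a $j$-pixel $p$ and reassigns it to a $j$-pixel $q$ that is empty before the move; moves are performed one at a time. A request is either $\textsc{Insert}(x)$ or $\textsc{Delete}(x)$, where $x$ is a unique identifier of a square of volume $v\in[0,1]$ (deletions refer to currently present squares); its volume is $v$ for an insertion and $-v$ for a deletion. A sequence of requests is valid if $\sum_{m=1}^{j}\mathrm{vol}(\sigma_m)\le 1$ for every $j$, and aligned if every $|\mathrm{vol}(\sigma_j)|$ equals $4^{ -\ell_j}$ for some $\ell_j\in\mathbb{N}_0$. Fulfilling an insertion of an $\ell$-square means performing a (possibly empty) sequence of moves and then assigning the square to an empty $\ell$-pixel; fulfilling a deletion means unassigning the square (possibly followed by moves). -}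

module Defs where

open import Data.Nat using (ℕ; zero; suc)
open import Data.Fin using (Fin)
open import Data.List using (List; []; _∷_; _++_; length)
open import Data.Product using (Σ; _×_; _,_; ∃; ∃-syntax)
open import Data.Unit using (⊤)
open import Data.Integer using (+_)
open import Data.Rational using (ℚ; _/_; 1ℚ; _*_; _+_; -_; _≤_)
open import Data.List.Relation.Unary.All using (All)
open import Data.List.Relation.Binary.Permutation.Propositional using (_↭_)
open import Relation.Nullary using (¬_)
open import Relation.Binary.PropositionalEquality using (_≡_)
open import Relation.Binary.Construct.Closure.ReflexiveTransitive using (Star)

-- A pixel is the path from the root to it: a list of quadrant choices.
-- The root [] is the 0-pixel; a j-pixel is a path of length j; its
-- four children are obtained by appending one of the four quadrants.
Pixel : Set
Pixel = List (Fin 4)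

layer : Pixel → ℕ
layer = length

AncOrEq : Pixel → Pixel → Set
AncOrEq p q = ∃[ r ] (p ++ r ≡ q)

Id : Set
Id = ℕ

-- A configuration: a finite list of (square identifier, pixel it is
-- assigned to).  The level of the square equals the layer of its pixel
-- (a j-square is assigned to a j-pixel).
Config : Set
Config = List (Id × Pixel)

emptyConfig : Config
emptyConfig = []

-- A pixel q is empty: it is not occupied, not blocked (no occupied
-- ancestor), and contains no square (no occupied descendant).
Empty : Config → Pixel → Set
Empty C q = All (λ e → ¬ AncOrEq (Data.Product.proj₂ e) q
                     × ¬ AncOrEq q (Data.Product.proj₂ e)) C

data Move : Config → Config → Set where
  move : ∀ {C R x p q} →
         C ↭ ((x , p) ∷ R) →
         Empty C q →
         layer q ≡ layer p →
         Move C ((x , q) ∷ R)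

Moves : Config → Config → Set
Moves = Star Move

-- Aligned requests: insert x ℓ inserts the ℓ-square x (volume 4^-ℓ);
-- delete x ℓ deletes the square x, which is an ℓ-square (the level is
-- recorded for convenience; it is forced by the well-formedness below).
data Request : Set where
  insert : Id → ℕ → Request
  delete : Id → ℕ → Request

quarterPow : ℕ → ℚ
quarterPow zero    = 1ℚ
quarterPow (suc n) = quarterPow n * (+ 1 / 4)

vol : Request → ℚ
vol (insert _ ℓ) = quarterPow ℓ
vol (delete _ ℓ) = - quarterPow ℓ

WellFormed : List (Id × ℕ) → List Request → Set
WellFormed S [] = ⊤
WellFormed S (insert x ℓ ∷ rs) =
  All (λ e → ¬ (Data.Product.proj₁ e ≡ x)) S × WellFormed ((x , ℓ) ∷ S) rs
WellFormed S (delete x ℓ ∷ rs) =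
  Σ (List (Id × ℕ)) λ S' → (S ↭ ((x , ℓ) ∷ S')) × WellFormed S' rs

ValidFrom : ℚ → List Request → Set
ValidFrom s [] = ⊤
ValidFrom s (r ∷ rs) = (s + vol r ≤ 1ℚ) × ValidFrom (s + vol r) rs

Valid : List Request → Set
Valid = ValidFrom (+ 0 / 1)

data Fulfill : Config → Request → Config → Set where
  fulfillInsert : ∀ {C C₁ x ℓ q} →
                  Moves C C₁ →
                  Empty C₁ q →
                  layer q ≡ ℓ →
                  Fulfill C (insert x ℓ) ((x , q) ∷ C₁)
  fulfillDelete : ∀ {C C₀ C' x ℓ p} →
                  C ↭ ((x , p) ∷ C₀) →
                  Moves C₀ C' →
                  Fulfill C (delete x ℓ) C'

data Fulfills : Config → List Request → Set where
  done : ∀ {C} → Fulfills C []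
  step : ∀ {C C' r rs} → Fulfill C r C' → Fulfills C' rs → Fulfills C (r ∷ rs)

module Submission where

-- Let D be the largest level in the sequence; we only use pixels of
-- layer ≤ D.  The state is kept as a tree (Tree) whose leaves are free
-- pixels or assigned squares and whose flattening is the configuration.
-- Invariant: at every depth at most 3 leaves are free.  The free volume,
-- counted in units 4^-D, is then a base-4 numeral with these counts as
-- digits (freeVolume), and it equals 4^D minus the weight of the present
-- squares (volume-partition).
-- * Insertion of an ℓ-square: validity says the free volume is at least
--   4^(D-ℓ), so by the digit bound some free leaf has depth ≤ ℓ; a spine
--   ending in the square is grafted into the deepest one (insertSquare).
-- * Deletion: the vacated leaf may be a fourth free leaf at its depth.
--   Then the siblings of one of them are relocated by moves into the
--   other free leaves (translate), the four free siblings merge into their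
--   parent, and this is repeated one level up (restore).

open import Defs
open import Data.List using (List; []; _∷_; _++_; length; map; replicate)

open import Data.Nat as N using (ℕ; zero; suc; _+_; _*_; _∸_; _^_; _≤_; _<_; z≤n; s≤s)
import Data.Nat.Properties as NP
open import Data.Nat.ListAction using (sum)
import Data.Nat.ListAction.Properties as SumP
open import Data.Nat.Solver using (module +-*-Solver)
open +-*-Solver using (solve; _:=_; con; _:+_; _:*_)
open import Data.Fin as F using (Fin)
import Data.List.Properties as LP
open import Data.List.Membership.Propositional using (_∈_)
import Data.List.Membership.Propositional.Properties as MemP
open import Data.List.Relation.Unary.Any using (here)
open import Data.List.Relation.Unary.All as All using (All; []; _∷_)
import Data.List.Relation.Unary.All.Properties as AllP
open import Data.List.Relation.Binary.Permutation.Propositional as Perm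
  using (_↭_; ↭-sym; ↭-trans; ↭-refl; ↭-reflexive)
import Data.List.Relation.Binary.Permutation.Propositional.Properties as PermP
open PermP using (shifts; ++⁺ˡ; ++⁺ʳ)
open import Data.Product using (_×_; _,_; ∃; proj₂)
open import Data.Sum using (_⊎_; inj₁; inj₂)
open import Data.Unit using (⊤; tt)
open import Data.Empty using (⊥; ⊥-elim)
open import Function using (_∘_; id)
open import Relation.Nullary using (¬_; Dec; yes; no)
open import Relation.Binary.PropositionalEquality as Eq
  using (_≡_; refl; sym; trans; cong; cong₂; subst; subst₂; _≢_)
open import Relation.Binary.Construct.Closure.ReflexiveTransitive using (ε; _◅_; _◅◅_)
import Data.Rational as Q
import Data.Rational.Properties as QP
import Data.Integer as ℤ

Disjoint : Pixel → Pixel → Set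
Disjoint p q = ∀ s t → p ++ s ≢ q ++ t

Disjoint-sym : ∀ {p q} → Disjoint p q → Disjoint q p
Disjoint-sym d s t e = d t s (sym e)

¬Disjoint-rootˡ : ∀ {q} → ¬ Disjoint [] q
¬Disjoint-rootˡ {q} d = d q [] (sym (LP.++-identityʳ q))

¬Disjoint-rootʳ : ∀ {q} → ¬ Disjoint q []
¬Disjoint-rootʳ d = ¬Disjoint-rootˡ (Disjoint-sym d)

Disjoint-quadrants : ∀ {i j : Fin 4} {p q} → i ≢ j → Disjoint (i ∷ p) (j ∷ q)
Disjoint-quadrants i≢j s t e = i≢j (LP.∷-injectiveˡ e)

Disjoint-∷ : ∀ {i : Fin 4} {p q} → Disjoint p q → Disjoint (i ∷ p) (i ∷ q)
Disjoint-∷ d s t e = d s t (LP.∷-injectiveʳ e)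

Disjoint-tail : ∀ {i : Fin 4} {p q} → Disjoint (i ∷ p) (i ∷ q) → Disjoint p q
Disjoint-tail d s t e = d s t (cong (_ ∷_) e)

Disjoint-prefix : ∀ c {p q} → Disjoint p q → Disjoint (c ++ p) (c ++ q)
Disjoint-prefix [] d = d
Disjoint-prefix (i ∷ c) d = Disjoint-∷ (Disjoint-prefix c d)

Disjoint-++ : ∀ {p q} s t → Disjoint p q → Disjoint (p ++ s) (q ++ t)
Disjoint-++ {p} {q} s t d s' t' e =
  d (s ++ s') (t ++ t') (trans (sym (LP.++-assoc p s s')) (trans e (LP.++-assoc q t t')))

Disjoint-++ʳ : ∀ {p q} t → Disjoint p q → Disjoint p (q ++ t)
Disjoint-++ʳ {p} {q} t d s t' e = d s (t ++ t') (trans e (LP.++-assoc q t t'))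

Disjoint⇒Incomparable : ∀ {p q} → Disjoint p q → ¬ AncOrEq p q × ¬ AncOrEq q p
Disjoint⇒Incomparable {p} {q} d =
    (λ { (r , e) → d r [] (trans e (sym (LP.++-identityʳ q))) })
  , (λ { (r , e) → d [] r (trans (LP.++-identityʳ p) (sym e)) })

-- A tree describes the part of the quadtree below a
-- pixel: a leaf is either a free pixel or a pixel with an assigned
-- square, and an inner node lists its four quadrants.  Every
-- configuration reached by the strategy is the flattening of a tree.

data Tree : Set where
  free   : Tree
  square : Id → Tree
  node   : Tree → Tree → Tree → Tree → Tree

pattern i₀ = F.zero
pattern i₁ = F.suc F.zero
pattern i₂ = F.suc (F.suc F.zero)
pattern i₃ = F.suc (F.suc (F.suc F.zero))

-- The i-th quadrant of a node (leaves are returned unchanged).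
child : Fin 4 → Tree → Tree
child i₀ (node a b c d) = a
child i₁ (node a b c d) = b
child i₂ (node a b c d) = c
child i₃ (node a b c d) = d
child i t = t

-- Replace the i-th quadrant of a node; choose i j y t is the new
-- j-th quadrant when the old one is t.  The result is always a node,
-- whatever i is.
choose : Fin 4 → Fin 4 → Tree → Tree → Tree
choose i j y t with i F.≟ j
... | yes _ = y
... | no _ = t

choose-≢ : ∀ {i j} y t → i ≢ j → choose i j y t ≡ t
choose-≢ {i} {j} y t i≢j with i F.≟ j
... | yes i≡j = ⊥-elim (i≢j i≡j)
... | no _ = refl

replaceChild : Fin 4 → Tree → Tree → Tree
replaceChild i y (node a b c d) = node (choose i i₀ y a) (choose i i₁ y b) (choose i i₂ y c) (choose i i₃ y d)
replaceChild i y t = t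

child-replaceChild : ∀ i y a b c d → child i (replaceChild i y (node a b c d)) ≡ y
child-replaceChild i₀ y a b c d = refl
child-replaceChild i₁ y a b c d = refl
child-replaceChild i₂ y a b c d = refl
child-replaceChild i₃ y a b c d = refl

child-replaceChild≢ : ∀ i j y a b c d → i ≢ j →
  child j (replaceChild i y (node a b c d)) ≡ child j (node a b c d)
child-replaceChild≢ i i₀ y a b c d = choose-≢ y a
child-replaceChild≢ i i₁ y a b c d = choose-≢ y b
child-replaceChild≢ i i₂ y a b c d = choose-≢ y c
child-replaceChild≢ i i₃ y a b c d = choose-≢ y d

replaceChild-child : ∀ i y a b c d → child i (node a b c d) ≡ y →
  replaceChild i y (node a b c d) ≡ node a b c d
replaceChild-child i₀ y a b c d refl = refl
replaceChild-child i₁ y a b c d refl = refl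
replaceChild-child i₂ y a b c d refl = refl
replaceChild-child i₃ y a b c d refl = refl

data At : Pixel → Tree → Tree → Set where
  here : ∀ {t} → At [] t t
  down : ∀ {a b c d i p X} → At p (child i (node a b c d)) X → At (i ∷ p) (node a b c d) X

graft : Pixel → Tree → Tree → Tree
graft [] X t = X
graft (i ∷ p) X t = replaceChild i (graft p X (child i t)) t

-- The configuration described by a tree: every square leaf at path r is
-- assigned to the pixel f r (f places the tree in the quadtree).
flatten : (Pixel → Pixel) → Tree → Config
flatten f free = []
flatten f (square x) = (x , f []) ∷ []
flatten f (node a b c d) =
  flatten (f ∘ (i₀ ∷_)) a ++ (flatten (f ∘ (i₁ ∷_)) b ++
  (flatten (f ∘ (i₂ ∷_)) c ++ flatten (f ∘ (i₃ ∷_)) d))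

module _ where
  open PermP using (++-assoc; ++-comm)
  open Perm.PermutationReasoning

  flatten-replaceChild : ∀ f i y a b c d →
    flatten f (replaceChild i y (node a b c d))
      ↭ flatten (f ∘ (i ∷_)) y ++ flatten f (replaceChild i free (node a b c d))
  flatten-replaceChild f i₀ y a b c d = ↭-refl
  flatten-replaceChild f i₁ y a b c d = shifts (flatten (f ∘ (i₀ ∷_)) a) (flatten (f ∘ (i₁ ∷_)) y)
  flatten-replaceChild f i₂ y a b c d = begin
    A ++ (B ++ (Y ++ D)) ↭⟨ ↭-sym (++-assoc A B (Y ++ D)) ⟩
    (A ++ B) ++ (Y ++ D) ↭⟨ shifts (A ++ B) Y ⟩
    Y ++ ((A ++ B) ++ D) ↭⟨ ++⁺ˡ Y (++-assoc A B D) ⟩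
    Y ++ (A ++ (B ++ D)) ∎
    where
    A = flatten (f ∘ (i₀ ∷_)) a ; B = flatten (f ∘ (i₁ ∷_)) b
    Y = flatten (f ∘ (i₂ ∷_)) y ; D = flatten (f ∘ (i₃ ∷_)) d
  flatten-replaceChild f i₃ y a b c d = begin
    A ++ (B ++ (C ++ Y)) ↭⟨ ↭-sym (++-assoc A B (C ++ Y)) ⟩
    (A ++ B) ++ (C ++ Y) ↭⟨ ↭-sym (++-assoc (A ++ B) C Y) ⟩
    ((A ++ B) ++ C) ++ Y ↭⟨ ++-comm ((A ++ B) ++ C) Y ⟩
    Y ++ ((A ++ B) ++ C) ↭⟨ ++⁺ˡ Y (++-assoc A B C) ⟩
    Y ++ (A ++ (B ++ C)) ↭⟨ ++⁺ˡ Y (++⁺ˡ A (++⁺ˡ B (↭-sym (PermP.++-identityʳ C)))) ⟩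
    Y ++ (A ++ (B ++ (C ++ []))) ∎
    where
    A = flatten (f ∘ (i₀ ∷_)) a ; B = flatten (f ∘ (i₁ ∷_)) b
    C = flatten (f ∘ (i₂ ∷_)) c ; Y = flatten (f ∘ (i₃ ∷_)) y

  flatten-graft : ∀ {a T Y} f X → At a T Y →
    flatten f (graft a X T) ↭ flatten (f ∘ (a ++_)) X ++ flatten f (graft a free T)
  flatten-graft f X here = ↭-sym (PermP.++-identityʳ (flatten f X))
  flatten-graft {i ∷ p} {node a b c d} f X (down at) = begin
    flatten f (replaceChild i (graft p X (child i T)) T)
      ↭⟨ flatten-replaceChild f i (graft p X (child i T)) a b c d ⟩
    flatten fᵢ (graft p X (child i T)) ++ Rest
      ↭⟨ ++⁺ʳ _ (flatten-graft fᵢ X at) ⟩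
    (flatten (fᵢ ∘ (p ++_)) X ++ flatten fᵢ (graft p free (child i T))) ++ Rest
      ↭⟨ ++-assoc (flatten (fᵢ ∘ (p ++_)) X) _ Rest ⟩
    flatten (fᵢ ∘ (p ++_)) X ++ (flatten fᵢ (graft p free (child i T)) ++ Rest)
      ↭⟨ ++⁺ˡ (flatten (fᵢ ∘ (p ++_)) X)
              (↭-sym (flatten-replaceChild f i (graft p free (child i T)) a b c d)) ⟩
    flatten (fᵢ ∘ (p ++_)) X ++ flatten f (replaceChild i (graft p free (child i T)) T) ∎
    where
    T = node a b c d
    fᵢ = f ∘ (i ∷_)
    Rest = flatten f (replaceChild i free T)

graft-At : ∀ {a T X} → At a T X → graft a X T ≡ T
graft-At here = refl
graft-At {i ∷ p} {node a b c d} (down at) rewrite graft-At at = replaceChild-child i _ a b c d refl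

flatten-split : ∀ {a T X} f → At a T X →
  flatten f T ↭ flatten (f ∘ (a ++_)) X ++ flatten f (graft a free T)
flatten-split {a} {T} {X} f at =
  subst (λ t → flatten f t ↭ flatten (f ∘ (a ++_)) X ++ flatten f (graft a free T))
        (graft-At at) (flatten-graft f X at)

flatten-All-At : ∀ {P : Id × Pixel → Set} f X →
  (∀ x r → At r X (square x) → P (x , f r)) → All P (flatten f X)
flatten-All-At f free H = []
flatten-All-At f (square x) H = H x [] here ∷ []
flatten-All-At f (node a b c d) H =
  AllP.++⁺ (flatten-All-At (f ∘ (i₀ ∷_)) a (λ x r at → H x (i₀ ∷ r) (down at)))
  (AllP.++⁺ (flatten-All-At (f ∘ (i₁ ∷_)) b (λ x r at → H x (i₁ ∷ r) (down at)))
  (AllP.++⁺ (flatten-All-At (f ∘ (i₂ ∷_)) c (λ x r at → H x (i₂ ∷ r) (down at)))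
            (flatten-All-At (f ∘ (i₃ ∷_)) d (λ x r at → H x (i₃ ∷ r) (down at)))))

flatten-All : ∀ {P : Id × Pixel → Set} f X → (∀ x r → P (x , f r)) → All P (flatten f X)
flatten-All f X H = flatten-All-At f X (λ x r _ → H x r)

flatten-∈ : ∀ {x p} f X → (x , p) ∈ flatten f X → ∃ λ r → p ≡ f r × At r X (square x)
flatten-∈ f free ()
flatten-∈ f (square x) (here refl) = [] , refl , here
flatten-∈ f (node a b c d) m with MemP.∈-++⁻ (flatten (f ∘ (i₀ ∷_)) a) m
... | inj₁ m' = let (r , e , at) = flatten-∈ (f ∘ (i₀ ∷_)) a m' in i₀ ∷ r , e , down at
... | inj₂ m₁ with MemP.∈-++⁻ (flatten (f ∘ (i₁ ∷_)) b) m₁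
... | inj₁ m' = let (r , e , at) = flatten-∈ (f ∘ (i₁ ∷_)) b m' in i₁ ∷ r , e , down at
... | inj₂ m₂ with MemP.∈-++⁻ (flatten (f ∘ (i₂ ∷_)) c) m₂
... | inj₁ m' = let (r , e , at) = flatten-∈ (f ∘ (i₂ ∷_)) c m' in i₂ ∷ r , e , down at
... | inj₂ m' = let (r , e , at) = flatten-∈ (f ∘ (i₃ ∷_)) d m' in i₃ ∷ r , e , down at

At-compare : ∀ {a b T Y Z} → At a T Y → At b T Z →
  Disjoint a b ⊎ ((∃ λ s → b ≡ a ++ s × At s Y Z) ⊎ (∃ λ s → a ≡ b ++ s × At s Z Y))
At-compare {b = b} here at₂ = inj₂ (inj₁ (b , refl , at₂))
At-compare {a = a} (down at₁) here = inj₂ (inj₂ (a , refl , down at₁))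
At-compare (down {i = i} at₁) (down {i = j} at₂) with i F.≟ j
... | no i≢j = inj₁ (Disjoint-quadrants i≢j)
... | yes refl with At-compare at₁ at₂
...   | inj₁ d = inj₁ (Disjoint-∷ d)
...   | inj₂ (inj₁ (s , e , at)) = inj₂ (inj₁ (s , cong (i ∷_) e , at))
...   | inj₂ (inj₂ (s , e , at)) = inj₂ (inj₂ (s , cong (i ∷_) e , at))

At-free : ∀ {s Z} → At s free Z → Z ≡ free
At-free here = refl

At-square : ∀ {s x Z} → At s (square x) Z → Z ≡ square x
At-square here = refl

leaves-disjoint : ∀ {a b x T} → At a T free → At b T (square x) → Disjoint a b
leaves-disjoint at₁ at₂ with At-compare at₁ at₂
... | inj₁ d = d
... | inj₂ (inj₁ (s , _ , at)) with At-free at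
... | ()
leaves-disjoint at₁ at₂ | inj₂ (inj₂ (s , _ , at)) with At-square at
... | ()

free-disjoint : ∀ {r T} → At r T free → All (λ e → Disjoint (proj₂ e) r) (flatten id T)
free-disjoint {r} {T} atr =
  flatten-All-At id T (λ x r' at' → Disjoint-sym (leaves-disjoint atr at'))

record Relocation (f g : Pixel → Pixel) : Set where
  field
    apart     : ∀ r s → Disjoint (f r) (g s)
    separates : ∀ r s → Disjoint r s → Disjoint (g r) (g s)
    sameLayer : ∀ r → length (f r) ≡ length (g r)

open Relocation

below : ∀ {f g} → Relocation f g → ∀ i → Relocation (f ∘ (i ∷_)) (g ∘ (i ∷_))
below rel i = record
  { apart     = λ r s → apart rel (i ∷ r) (i ∷ s)
  ; separates = λ r s d → separates rel (i ∷ r) (i ∷ s) (Disjoint-∷ d)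
  ; sameLayer = λ r → sameLayer rel (i ∷ r) }

AwayFrom : (Pixel → Pixel) → Config → Set
AwayFrom g R = All (λ e → ∀ s → Disjoint (proj₂ e) (g s)) R

-- Permutation bookkeeping for translate: the relocated children are
-- kept at the front of the configuration.
module _ where
  open PermP using (++-assoc)

  toFront₁ : ∀ (X Y W : Config) → X ++ (Y ++ W) ↭ Y ++ (X ++ W)
  toFront₁ X Y W = shifts X Y

  toFront₂ : ∀ (X Y Z W : Config) → X ++ (Y ++ (Z ++ W)) ↭ Z ++ (X ++ (Y ++ W))
  toFront₂ X Y Z W = ↭-trans (++⁺ˡ X (shifts Y Z)) (shifts X Z)

  toFront₃ : ∀ (X Y Z V W : Config) → X ++ (Y ++ (Z ++ (V ++ W))) ↭ V ++ (X ++ (Y ++ (Z ++ W)))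
  toFront₃ X Y Z V W = ↭-trans (++⁺ˡ X (toFront₂ Y Z V W)) (shifts X V)

  assoc₄ : ∀ (A B C D R : Config) → (A ++ (B ++ (C ++ D))) ++ R ≡ A ++ (B ++ (C ++ (D ++ R)))
  assoc₄ A B C D R
    rewrite LP.++-assoc A (B ++ (C ++ D)) R | LP.++-assoc B (C ++ D) R | LP.++-assoc C D R = refl

-- Squares are moved one at a time; each target pixel is empty since it
-- is disjoint from the rest of X's source, from R, and from the part of
-- X already relocated.
translate : ∀ X {f g} (R C : Config) → Relocation f g → AwayFrom g R →
  C ↭ flatten f X ++ R → ∃ λ C' → Moves C C' × C' ↭ flatten g X ++ R
translate free R C rel away C↭ = C , ε , C↭
translate (square x) {f} {g} R C rel away C↭ =
  (x , g []) ∷ R , move C↭ empty (sym (sameLayer rel [])) ◅ ε , ↭-refl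
  where
  empty : Empty C (g [])
  empty = PermP.All-resp-↭ (↭-sym C↭)
            ( Disjoint⇒Incomparable (apart rel [] [])
            ∷ All.map (λ d → Disjoint⇒Incomparable (d [])) away)
translate (node a b c d) {f} {g} R C rel away C↭ = moveChildren
  where
  A = flatten (f ∘ (i₀ ∷_)) a ; B = flatten (f ∘ (i₁ ∷_)) b
  Cs = flatten (f ∘ (i₂ ∷_)) c ; Ds = flatten (f ∘ (i₃ ∷_)) d
  A' = flatten (g ∘ (i₀ ∷_)) a ; B' = flatten (g ∘ (i₁ ∷_)) b
  Cs' = flatten (g ∘ (i₂ ∷_)) c ; Ds' = flatten (g ∘ (i₃ ∷_)) d
  -- not yet moved children are at their source, away from every target
  src : ∀ j i X → AwayFrom (g ∘ (i ∷_)) (flatten (f ∘ (j ∷_)) X)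
  src j i X = flatten-All (f ∘ (j ∷_)) X (λ x r s → apart rel (j ∷ r) (i ∷ s))
  -- already moved children lie in other quadrants of the target
  tgt : ∀ j i X → j ≢ i → AwayFrom (g ∘ (i ∷_)) (flatten (g ∘ (j ∷_)) X)
  tgt j i X j≢i = flatten-All (g ∘ (j ∷_)) X
                    (λ x r s → separates rel (j ∷ r) (i ∷ s) (Disjoint-quadrants j≢i))
  rest : ∀ i → AwayFrom (g ∘ (i ∷_)) R
  rest i = All.map (λ d s → d (i ∷ s)) away
  reorder : Ds' ++ (Cs' ++ (B' ++ (A' ++ R))) ↭ flatten g (node a b c d) ++ R
  reorder = ↭-trans (↭-sym (toFront₃ Cs' B' A' Ds' R))
            (↭-trans (toFront₂ Cs' B' A' (Ds' ++ R))
            (↭-trans (++⁺ˡ A' (toFront₁ Cs' B' (Ds' ++ R)))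
            (↭-reflexive (sym (assoc₄ A' B' Cs' Ds' R)))))
  moveChildren : ∃ λ C' → Moves C C' × C' ↭ flatten g (node a b c d) ++ R
  moveChildren
    with translate a (B ++ (Cs ++ (Ds ++ R))) C (below rel i₀)
           (AllP.++⁺ (src i₁ i₀ b) (AllP.++⁺ (src i₂ i₀ c) (AllP.++⁺ (src i₃ i₀ d) (rest i₀))))
           (↭-trans C↭ (↭-reflexive (assoc₄ A B Cs Ds R)))
  ... | C₁ , m₀ , C₁↭ with translate b (A' ++ (Cs ++ (Ds ++ R))) C₁ (below rel i₁)
           (AllP.++⁺ (tgt i₀ i₁ a (λ ())) (AllP.++⁺ (src i₂ i₁ c) (AllP.++⁺ (src i₃ i₁ d) (rest i₁))))
           (↭-trans C₁↭ (toFront₁ A' B (Cs ++ (Ds ++ R))))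
  ... | C₂ , m₁ , C₂↭ with translate c (B' ++ (A' ++ (Ds ++ R))) C₂ (below rel i₂)
           (AllP.++⁺ (tgt i₁ i₂ b (λ ())) (AllP.++⁺ (tgt i₀ i₂ a (λ ()))
             (AllP.++⁺ (src i₃ i₂ d) (rest i₂))))
           (↭-trans C₂↭ (toFront₂ B' A' Cs (Ds ++ R)))
  ... | C₃ , m₂ , C₃↭ with translate d (Cs' ++ (B' ++ (A' ++ R))) C₃ (below rel i₃)
           (AllP.++⁺ (tgt i₂ i₃ c (λ ())) (AllP.++⁺ (tgt i₁ i₃ b (λ ()))
             (AllP.++⁺ (tgt i₀ i₃ a (λ ())) (rest i₃))))
           (↭-trans C₃↭ (toFront₃ Cs' B' A' Ds R))
  ... | C₄ , m₃ , C₄↭ = C₄ , m₀ ◅◅ (m₁ ◅◅ (m₂ ◅◅ m₃)) , ↭-trans C₄↭ reorder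

At-++ : ∀ {P T Y q Z} → At P T Y → At q Y Z → At (P ++ q) T Z
At-++ here at₂ = at₂
At-++ (down at) at₂ = down (At-++ at at₂)

At-graft-below : ∀ {P T Y} q X → At P T Y → At P (graft (P ++ q) X T) (graft q X Y)
At-graft-below q X here = here
At-graft-below {i ∷ p} {node a b c d} q X (down at) =
  down (subst (λ t → At p t _) (sym (child-replaceChild i (graft (p ++ q) X (child i (node a b c d))) a b c d))
              (At-graft-below q X at))

At-graft : ∀ {P T Y} X → At P T Y → At P (graft P X T) X
At-graft {P} {T} X at = subst (λ p → At P (graft p X T) X) (LP.++-identityʳ P) (At-graft-below [] X at)

At-graft-disjoint : ∀ {P T Y} g X → At P T Y → Disjoint P g → At P (graft g X T) Y
At-graft-disjoint g X here d = ⊥-elim (¬Disjoint-rootˡ d)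
At-graft-disjoint [] X (down at) d = ⊥-elim (¬Disjoint-rootʳ d)
At-graft-disjoint {i ∷ p} {node a b c d} (j ∷ g) X (down at) dis with i F.≟ j
... | yes refl = down (subst (λ t → At p t _) (sym (child-replaceChild i (graft g X (child i (node a b c d))) a b c d))
                        (At-graft-disjoint g X at (Disjoint-tail dis)))
... | no i≢j = down (subst (λ t → At p t _)
                      (sym (child-replaceChild≢ j i (graft g X (child j (node a b c d))) a b c d
                                                 (λ e → i≢j (sym e)))) at)

At-graft-disjoint⁻ : ∀ {P T Y g Z} X → At P T Y → Disjoint g P → At g (graft P X T) Z → At g T Z
At-graft-disjoint⁻ X here d at' = ⊥-elim (¬Disjoint-rootʳ d)
At-graft-disjoint⁻ {g = []} X (down at) d at' = ⊥-elim (¬Disjoint-rootˡ d)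
At-graft-disjoint⁻ {i ∷ p} {node a b c d} {g = j ∷ g} X (down at) dis (down at') with i F.≟ j
... | yes refl = down (At-graft-disjoint⁻ X at (Disjoint-tail dis)
                        (subst (λ t → At g t _) (child-replaceChild i (graft p X (child i (node a b c d))) a b c d) at'))
... | no i≢j = down (subst (λ t → At g t _)
                      (child-replaceChild≢ i j (graft p X (child i (node a b c d))) a b c d i≢j) at')

At-parent : ∀ {i p T X} → At (i ∷ p) T X →
  ∃ λ P → length P ≡ length p × ∃ λ a → ∃ λ b → ∃ λ c → ∃ λ d → At P T (node a b c d)
At-parent (down {a = a} {b} {c} {d} {p = []} _) = [] , refl , a , b , c , d , here
At-parent (down {i = i} {p = _ ∷ _} at) with At-parent at
... | P , e , a , b , c , d , atP = i ∷ P , cong suc e , a , b , c , d , down atP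

-- Counting free leaves.  freeAt T k is the number of free leaves of T
-- at depth k; the strategy keeps it at most 3 for every k (FewFree),
-- i.e. it behaves like a base-4 digit of the free volume.

freeAt : Tree → ℕ → ℕ
freeAt free zero = 1
freeAt free (suc k) = 0
freeAt (square x) k = 0
freeAt (node a b c d) zero = 0
freeAt (node a b c d) (suc k) = freeAt a k + (freeAt b k + (freeAt c k + freeAt d k))

FewFree : Tree → Set
FewFree T = ∀ k → freeAt T k ≤ 3

freeAt-root : ∀ T → freeAt T 0 ≤ 1
freeAt-root free = s≤s z≤n
freeAt-root (square x) = z≤n
freeAt-root (node a b c d) = z≤n

shiftBy : ℕ → (ℕ → ℕ) → ℕ → ℕ
shiftBy zero c k = c k
shiftBy (suc n) c zero = 0
shiftBy (suc n) c (suc k) = shiftBy n c k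

shiftBy-< : ∀ n c k → k < n → shiftBy n c k ≡ 0
shiftBy-< (suc n) c zero _ = refl
shiftBy-< (suc n) c (suc k) (s≤s k<n) = shiftBy-< n c k k<n

shiftBy-+ : ∀ n c i → shiftBy n c (n + i) ≡ c i
shiftBy-+ zero c i = refl
shiftBy-+ (suc n) c i = shiftBy-+ n c i

freeAt-replaceChild : ∀ i y a b c d k →
  freeAt (replaceChild i y (node a b c d)) (suc k) + freeAt (child i (node a b c d)) k
    ≡ freeAt (node a b c d) (suc k) + freeAt y k
freeAt-replaceChild i₀ y a b c d k =
  solve 5 (λ y a b c d → (y :+ (b :+ (c :+ d))) :+ a := (a :+ (b :+ (c :+ d))) :+ y) refl
    (freeAt y k) (freeAt a k) (freeAt b k) (freeAt c k) (freeAt d k)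
freeAt-replaceChild i₁ y a b c d k =
  solve 5 (λ y a b c d → (a :+ (y :+ (c :+ d))) :+ b := (a :+ (b :+ (c :+ d))) :+ y) refl
    (freeAt y k) (freeAt a k) (freeAt b k) (freeAt c k) (freeAt d k)
freeAt-replaceChild i₂ y a b c d k =
  solve 5 (λ y a b c d → (a :+ (b :+ (y :+ d))) :+ c := (a :+ (b :+ (c :+ d))) :+ y) refl
    (freeAt y k) (freeAt a k) (freeAt b k) (freeAt c k) (freeAt d k)
freeAt-replaceChild i₃ y a b c d k =
  solve 5 (λ y a b c d → (a :+ (b :+ (c :+ y))) :+ d := (a :+ (b :+ (c :+ d))) :+ y) refl
    (freeAt y k) (freeAt a k) (freeAt b k) (freeAt c k) (freeAt d k)

freeAt-graft : ∀ {a T Y} X → At a T Y → ∀ k →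
  freeAt (graft a X T) k + shiftBy (length a) (freeAt Y) k ≡ freeAt T k + shiftBy (length a) (freeAt X) k
freeAt-graft {T = T} X here k = NP.+-comm (freeAt X k) (freeAt T k)
freeAt-graft X (down at) zero = refl
freeAt-graft {i ∷ p} {node a b c d} {Y} X (down at) (suc k) =
  NP.+-cancelʳ-≡ (freeAt (child i T) k) _ _ (begin
    U + shY + cI          ≡⟨ solve 3 (λ u y i → u :+ y :+ i := u :+ i :+ y) refl U shY cI ⟩
    U + cI + shY          ≡⟨ cong (_+ shY) (freeAt-replaceChild i Z a b c d k) ⟩
    cT + cZ + shY         ≡⟨ NP.+-assoc cT cZ shY ⟩
    cT + (cZ + shY)       ≡⟨ cong (cT +_) (freeAt-graft X at k) ⟩
    cT + (cI + shX)       ≡⟨ solve 3 (λ t i x → t :+ (i :+ x) := t :+ x :+ i) refl cT cI shX ⟩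
    cT + shX + cI ∎)
  where
  open Eq.≡-Reasoning
  T = node a b c d
  Z = graft p X (child i T)
  U = freeAt (replaceChild i Z T) (suc k)
  cI = freeAt (child i T) k
  cT = freeAt T (suc k)
  cZ = freeAt Z k
  shY = shiftBy (length p) (freeAt Y) k
  shX = shiftBy (length p) (freeAt X) k

freeAt-graft-< : ∀ {a T Y} X → At a T Y → ∀ k → k < length a → freeAt (graft a X T) k ≡ freeAt T k
freeAt-graft-< {a} {T} {Y} X at k k<a = NP.+-cancelʳ-≡ 0 _ _ (begin
  freeAt (graft a X T) k + 0
    ≡⟨ cong (freeAt (graft a X T) k +_) (sym (shiftBy-< (length a) (freeAt Y) k k<a)) ⟩
  freeAt (graft a X T) k + shiftBy (length a) (freeAt Y) k
    ≡⟨ freeAt-graft X at k ⟩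
  freeAt T k + shiftBy (length a) (freeAt X) k
    ≡⟨ cong (freeAt T k +_) (shiftBy-< (length a) (freeAt X) k k<a) ⟩
  freeAt T k + 0 ∎)
  where open Eq.≡-Reasoning

freeAt-graft-+ : ∀ {a T Y} X → At a T Y → ∀ i →
  freeAt (graft a X T) (length a + i) + freeAt Y i ≡ freeAt T (length a + i) + freeAt X i
freeAt-graft-+ {a} {T} {Y} X at i = begin
  freeAt (graft a X T) (length a + i) + freeAt Y i
    ≡⟨ cong (freeAt (graft a X T) (length a + i) +_) (sym (shiftBy-+ (length a) (freeAt Y) i)) ⟩
  freeAt (graft a X T) (length a + i) + shiftBy (length a) (freeAt Y) (length a + i)
    ≡⟨ freeAt-graft X at (length a + i) ⟩
  freeAt T (length a + i) + shiftBy (length a) (freeAt X) (length a + i)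
    ≡⟨ cong (freeAt T (length a + i) +_) (shiftBy-+ (length a) (freeAt X) i) ⟩
  freeAt T (length a + i) + freeAt X i ∎
  where open Eq.≡-Reasoning

depth-split : ∀ n k → k < n ⊎ (∃ λ i → k ≡ n + i)
depth-split n k with k N.<? n
... | yes k<n = inj₁ k<n
... | no k≮n = inj₂ (k ∸ n , sym (NP.m+[n∸m]≡n (NP.≮⇒≥ k≮n)))

-- Depth bounds: all leaves of the tree have depth at most e.  The
-- strategy works inside a quadtree truncated at the largest level D
-- occurring in the request sequence.

Depth≤ : ℕ → Tree → Set
Depth≤ e free = ⊤
Depth≤ e (square x) = ⊤
Depth≤ zero (node a b c d) = ⊥
Depth≤ (suc e) (node a b c d) = Depth≤ e a × Depth≤ e b × Depth≤ e c × Depth≤ e d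

Depth≤-child : ∀ e i a b c d → Depth≤ (suc e) (node a b c d) → Depth≤ e (child i (node a b c d))
Depth≤-child e i₀ a b c d (ba , bb , bc , bd) = ba
Depth≤-child e i₁ a b c d (ba , bb , bc , bd) = bb
Depth≤-child e i₂ a b c d (ba , bb , bc , bd) = bc
Depth≤-child e i₃ a b c d (ba , bb , bc , bd) = bd

Depth≤-choose : ∀ e i j y t → Depth≤ e y → Depth≤ e t → Depth≤ e (choose i j y t)
Depth≤-choose e i j y t by bt with i F.≟ j
... | yes _ = by
... | no _ = bt

Depth≤-replaceChild : ∀ e i y a b c d → Depth≤ (suc e) (node a b c d) → Depth≤ e y →
  Depth≤ (suc e) (replaceChild i y (node a b c d))
Depth≤-replaceChild e i y a b c d (ba , bb , bc , bd) by =
  Depth≤-choose e i i₀ y a by ba , Depth≤-choose e i i₁ y b by bb ,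
  Depth≤-choose e i i₂ y c by bc , Depth≤-choose e i i₃ y d by bd

Depth≤-At : ∀ D {a T Y} → At a T Y → Depth≤ D T → Depth≤ (D ∸ length a) Y
Depth≤-At D here b = b
Depth≤-At (suc D) {i ∷ p} {node a b c d} (down at) bT = Depth≤-At D at (Depth≤-child D i a b c d bT)

Depth≤-graft : ∀ D {a T Y} X → At a T Y → Depth≤ D T → Depth≤ (D ∸ length a) X → Depth≤ D (graft a X T)
Depth≤-graft D X here bT bX = bX
Depth≤-graft (suc D) {i ∷ p} {node a b c d} X (down at) bT bX =
  Depth≤-replaceChild D i _ a b c d bT (Depth≤-graft D X at (Depth≤-child D i a b c d bT) bX)

-- Volumes, in units of the smallest square 4^-e considered.  The used
-- and the free volume of a tree of depth at most e add up to 4^e.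

usedVolume : ℕ → Tree → ℕ
usedVolume e free = 0
usedVolume e (square x) = 4 ^ e
usedVolume zero (node a b c d) = 0
usedVolume (suc e) (node a b c d) = usedVolume e a + (usedVolume e b + (usedVolume e c + usedVolume e d))

-- freeVolume c e = Σ_{k ≤ e} c k · 4^(e-k), by Horner's rule: the
-- volume of c k free pixels at each depth k.
freeVolume : (ℕ → ℕ) → ℕ → ℕ
freeVolume c zero = c zero
freeVolume c (suc e) = 4 * freeVolume c e + c (suc e)

freeVolume-free : ∀ e → freeVolume (freeAt free) e ≡ 4 ^ e
freeVolume-free zero = refl
freeVolume-free (suc e) = trans (NP.+-identityʳ (4 * freeVolume (freeAt free) e)) (cong (4 *_) (freeVolume-free e))

freeVolume-square : ∀ x e → freeVolume (freeAt (square x)) e ≡ 0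
freeVolume-square x zero = refl
freeVolume-square x (suc e) =
  trans (NP.+-identityʳ (4 * freeVolume (freeAt (square x)) e))
        (trans (cong (4 *_) (freeVolume-square x e)) (NP.*-zeroʳ 4))

freeVolume-node : ∀ a b c d e → freeVolume (freeAt (node a b c d)) (suc e)
  ≡ freeVolume (freeAt a) e + (freeVolume (freeAt b) e + (freeVolume (freeAt c) e + freeVolume (freeAt d) e))
freeVolume-node a b c d zero = refl
freeVolume-node a b c d (suc e) =
  trans (cong (λ v → 4 * v + freeAt (node a b c d) (suc (suc e))) (freeVolume-node a b c d e))
    (solve 8 (λ ga gb gc gd ca cb cc cd →
       con 4 :* (ga :+ (gb :+ (gc :+ gd))) :+ (ca :+ (cb :+ (cc :+ cd)))
       := (con 4 :* ga :+ ca) :+ ((con 4 :* gb :+ cb) :+ ((con 4 :* gc :+ cc) :+ (con 4 :* gd :+ cd)))) refl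
       (freeVolume (freeAt a) e) (freeVolume (freeAt b) e) (freeVolume (freeAt c) e) (freeVolume (freeAt d) e)
       (freeAt a (suc e)) (freeAt b (suc e)) (freeAt c (suc e)) (freeAt d (suc e)))

volume-partition : ∀ e T → Depth≤ e T → usedVolume e T + freeVolume (freeAt T) e ≡ 4 ^ e
volume-partition e free _ = freeVolume-free e
volume-partition e (square x) _ = trans (cong (4 ^ e +_) (freeVolume-square x e)) (NP.+-identityʳ (4 ^ e))
volume-partition (suc e) (node a b c d) (ba , bb , bc , bd) = begin
    (ua + (ub + (uc + ud))) + freeVolume (freeAt (node a b c d)) (suc e)
      ≡⟨ cong ((ua + (ub + (uc + ud))) +_) (freeVolume-node a b c d e) ⟩
    (ua + (ub + (uc + ud))) + (fa + (fb + (fc + fd)))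
      ≡⟨ solve 8 (λ ua ub uc ud fa fb fc fd →
            (ua :+ (ub :+ (uc :+ ud))) :+ (fa :+ (fb :+ (fc :+ fd)))
            := (ua :+ fa) :+ ((ub :+ fb) :+ ((uc :+ fc) :+ (ud :+ fd)))) refl ua ub uc ud fa fb fc fd ⟩
    (ua + fa) + ((ub + fb) + ((uc + fc) + (ud + fd)))
      ≡⟨ cong₂ _+_ (volume-partition e a ba) (cong₂ _+_ (volume-partition e b bb)
                   (cong₂ _+_ (volume-partition e c bc) (volume-partition e d bd))) ⟩
    4 ^ e + (4 ^ e + (4 ^ e + 4 ^ e))
      ≡⟨ solve 1 (λ x → x :+ (x :+ (x :+ x)) := con 4 :* x) refl (4 ^ e) ⟩
    4 * 4 ^ e ∎
  where
  open Eq.≡-Reasoning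
  ua = usedVolume e a ; ub = usedVolume e b ; uc = usedVolume e c ; ud = usedVolume e d
  fa = freeVolume (freeAt a) e ; fb = freeVolume (freeAt b) e
  fc = freeVolume (freeAt c) e ; fd = freeVolume (freeAt d) e

-- The squares present, as (identifier, level) pairs, and their total
-- volume in units of 4^-D.

levelOf : Id × Pixel → Id × ℕ
levelOf (x , p) = x , length p

weight : ℕ → List (Id × ℕ) → ℕ
weight D S = sum (map (λ e → 4 ^ (D ∸ proj₂ e)) S)

weight-++ : ∀ D S S' → weight D (S ++ S') ≡ weight D S + weight D S'
weight-++ D S S' = trans (cong sum (LP.map-++ _ S S')) (SumP.sum-++ (map _ S) (map _ S'))

weight-↭ : ∀ D {S S'} → S ↭ S' → weight D S ≡ weight D S'
weight-↭ D S↭S' = SumP.sum-↭ (PermP.map⁺ _ S↭S')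

flatten-weight : ∀ e T f k D → Depth≤ e T → (∀ r → length (f r) ≡ k + length r) → k + e ≡ D →
  weight D (map levelOf (flatten f T)) ≡ usedVolume e T
flatten-weight e free f k D _ lf ke = refl
flatten-weight e (square x) f k D _ lf ke =
  trans (NP.+-identityʳ _) (trans (cong (λ l → 4 ^ (D ∸ l)) (trans (lf []) (NP.+-identityʳ k)))
    (cong (4 ^_) (trans (cong (_∸ k) (sym ke)) (NP.m+n∸m≡n k e))))
flatten-weight (suc e) (node a b c d) f k D (ba , bb , bc , bd) lf ke =
  trans (weight-flatten-++ i₀ a) (cong₂ _+_ (sub i₀ a ba)
  (trans (weight-flatten-++ i₁ b) (cong₂ _+_ (sub i₁ b bb)
  (trans (weight-flatten-++ i₂ c) (cong₂ _+_ (sub i₂ c bc) (sub i₃ d bd))))))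
  where
  weight-flatten-++ : ∀ i t {R} → weight D (map levelOf (flatten (f ∘ (i ∷_)) t ++ R))
                        ≡ weight D (map levelOf (flatten (f ∘ (i ∷_)) t)) + weight D (map levelOf R)
  weight-flatten-++ i t {R} = trans (cong (weight D) (LP.map-++ levelOf (flatten (f ∘ (i ∷_)) t) R))
                                    (weight-++ D (map levelOf (flatten (f ∘ (i ∷_)) t)) _)
  sub : ∀ i t → Depth≤ e t → weight D (map levelOf (flatten (f ∘ (i ∷_)) t)) ≡ usedVolume e t
  sub i t bt = flatten-weight e t (f ∘ (i ∷_)) (suc k) D bt
    (λ r → trans (lf (i ∷ r)) (NP.+-suc k (length r)))
    (trans (sym (NP.+-suc k e)) ke)

freeVolume-zero : ∀ c l → (∀ k → k ≤ l → c k ≡ 0) → freeVolume c l ≡ 0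
freeVolume-zero c zero h = h 0 z≤n
freeVolume-zero c (suc l) h
  rewrite freeVolume-zero c l (λ k k≤l → h k (NP.m≤n⇒m≤1+n k≤l)) | h (suc l) NP.≤-refl = refl

freeVolume-< : ∀ c l → (∀ k → k ≤ l → c k ≡ 0) → (∀ k → c k ≤ 3) →
  ∀ n → freeVolume c (l + n) < 4 ^ n
freeVolume-< c l zeros digits zero rewrite NP.+-identityʳ l | freeVolume-zero c l zeros = NP.≤-refl
freeVolume-< c l zeros digits (suc n) rewrite NP.+-suc l n =
  NP.≤-trans (s≤s (NP.+-monoʳ-≤ (4 * v) (digits (suc (l + n)))))
    (NP.≤-trans (NP.≤-reflexive (solve 1 (λ v → con 1 :+ (con 4 :* v :+ con 3) := con 4 :* (con 1 :+ v)) refl v))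
      (NP.*-monoʳ-≤ 4 (freeVolume-< c l zeros digits n)))
  where v = freeVolume c (l + n)

lastNonzero : ∀ (c : ℕ → ℕ) l → (∀ k → k ≤ l → c k ≡ 0) ⊎
  (∃ λ k → k ≤ l × c k ≢ 0 × (∀ j → k < j → j ≤ l → c j ≡ 0))
lastNonzero c zero with c 0 N.≟ 0
... | yes c0≡0 = inj₁ (λ { k z≤n → c0≡0 })
... | no c0≢0 = inj₂ (0 , z≤n , c0≢0 , λ { j 0<j z≤n → ⊥-elim (NP.<-irrefl refl 0<j) })
lastNonzero c (suc l) with c (suc l) N.≟ 0
... | no cl≢0 = inj₂ (suc l , NP.≤-refl , cl≢0 , λ j l<j j≤l → ⊥-elim (NP.<⇒≱ l<j j≤l))
... | yes cl≡0 with lastNonzero c l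
...   | inj₁ zeros = inj₁ zeros'
  where
  zeros' : ∀ k → k ≤ suc l → c k ≡ 0
  zeros' k k≤l with NP.m≤n⇒m<n∨m≡n k≤l
  ... | inj₁ k<l = zeros k (NP.≤-pred k<l)
  ... | inj₂ refl = cl≡0
...   | inj₂ (k , k≤l , ck≢0 , after) = inj₂ (k , NP.m≤n⇒m≤1+n k≤l , ck≢0 , after')
  where
  after' : ∀ j → k < j → j ≤ suc l → c j ≡ 0
  after' j k<j j≤l with NP.m≤n⇒m<n∨m≡n j≤l
  ... | inj₁ j<l = after j k<j (NP.≤-pred j<l)
  ... | inj₂ refl = cl≡0

freeLeafAt : ∀ T k → freeAt T k ≢ 0 → ∃ λ r → length r ≡ k × At r T free
freeLeafAt free zero _ = [] , refl , here
freeLeafAt free (suc k) n≢0 = ⊥-elim (n≢0 refl)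
freeLeafAt (square x) k n≢0 = ⊥-elim (n≢0 refl)
freeLeafAt (node a b c d) zero n≢0 = ⊥-elim (n≢0 refl)
freeLeafAt (node a b c d) (suc k) n≢0 with freeAt a k N.≟ 0
... | no na = let (r , e , at) = freeLeafAt a k na in i₀ ∷ r , cong suc e , down at
... | yes za with freeAt b k N.≟ 0
... | no nb = let (r , e , at) = freeLeafAt b k nb in i₁ ∷ r , cong suc e , down at
... | yes zb with freeAt c k N.≟ 0
... | no nc = let (r , e , at) = freeLeafAt c k nc in i₂ ∷ r , cong suc e , down at
... | yes zc with freeAt d k N.≟ 0
... | no nd = let (r , e , at) = freeLeafAt d k nd in i₃ ∷ r , cong suc e , down at
... | yes zd = ⊥-elim (n≢0 (cong₂ _+_ za (cong₂ _+_ zb (cong₂ _+_ zc zd))))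

-- An ℓ-square is put into the last free leaf r of depth
-- k ≤ ℓ, inside a spine of ℓ - k nested first quadrants.  Each level
-- of the spine leaves three free siblings, at depths where T had no free
-- leaves, so the digit bound survives.

spine : ℕ → Id → Tree
spine zero x = square x
spine (suc n) x = node (spine n x) free free free

flatten-spine : ∀ f n x → flatten f (spine n x) ≡ (x , f (replicate n i₀)) ∷ []
flatten-spine f zero x = refl
flatten-spine f (suc n) x rewrite flatten-spine (f ∘ (i₀ ∷_)) n x = refl

freeAt-spine-root : ∀ n x → freeAt (spine n x) 0 ≡ 0
freeAt-spine-root zero x = refl
freeAt-spine-root (suc n) x = refl

freeAt-spine-≤ : ∀ n x j → freeAt (spine n x) j ≤ 3
freeAt-spine-≤ zero x j = z≤n
freeAt-spine-≤ (suc n) x zero = z≤n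
freeAt-spine-≤ (suc n) x (suc zero) rewrite freeAt-spine-root n x = NP.≤-refl
freeAt-spine-≤ (suc n) x (suc (suc j))
  rewrite NP.+-identityʳ (freeAt (spine n x) (suc j)) = freeAt-spine-≤ n x (suc j)

freeAt-spine-> : ∀ n x j → n < j → freeAt (spine n x) j ≡ 0
freeAt-spine-> zero x j _ = refl
freeAt-spine-> (suc n) x (suc (suc j)) (s≤s n<j)
  rewrite NP.+-identityʳ (freeAt (spine n x) (suc j)) = freeAt-spine-> n x (suc j) n<j

Depth≤-spine : ∀ n x e → n ≤ e → Depth≤ e (spine n x)
Depth≤-spine zero x e _ = tt
Depth≤-spine (suc n) x (suc e) (s≤s n≤e) = Depth≤-spine n x e n≤e , tt , tt , tt

FewFree-graft-spine : ∀ {r T} x n → At r T free → FewFree T →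
  (∀ j → length r < j → j ≤ length r + n → freeAt T j ≡ 0) → FewFree (graft r (spine n x) T)
FewFree-graft-spine {r} {T} x n at few gap k with depth-split (length r) k
... | inj₁ k<r = subst (_≤ 3) (sym (freeAt-graft-< (spine n x) at k k<r)) (few k)
... | inj₂ (i , refl) = inSpine i (freeAt-graft-+ (spine n x) at i)
  where
  T' = graft r (spine n x) T
  open NP.≤-Reasoning
  inSpine : ∀ i → freeAt T' (length r + i) + freeAt free i ≡ freeAt T (length r + i) + freeAt (spine n x) i →
            freeAt T' (length r + i) ≤ 3
  inSpine zero e = begin
    freeAt T' (length r + 0)                            ≤⟨ NP.m≤m+n _ 1 ⟩
    freeAt T' (length r + 0) + 1                        ≡⟨ e ⟩
    freeAt T (length r + 0) + freeAt (spine n x) 0      ≡⟨ cong (freeAt T (length r + 0) +_) (freeAt-spine-root n x) ⟩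
    freeAt T (length r + 0) + 0                         ≡⟨ NP.+-identityʳ _ ⟩
    freeAt T (length r + 0)                             ≤⟨ few _ ⟩
    3 ∎
  inSpine (suc i) e with suc i N.≤? n
  ... | yes i<n = begin
    freeAt T' (length r + suc i)                        ≡⟨ sym (NP.+-identityʳ _) ⟩
    freeAt T' (length r + suc i) + 0                    ≡⟨ e ⟩
    freeAt T (length r + suc i) + freeAt (spine n x) (suc i)
      ≡⟨ cong (_+ freeAt (spine n x) (suc i)) (gap _ (NP.m<m+n (length r) (s≤s z≤n)) (NP.+-monoʳ-≤ (length r) i<n)) ⟩
    freeAt (spine n x) (suc i)                          ≤⟨ freeAt-spine-≤ n x (suc i) ⟩
    3 ∎
  ... | no i≮n = begin
    freeAt T' (length r + suc i)                        ≡⟨ sym (NP.+-identityʳ _) ⟩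
    freeAt T' (length r + suc i) + 0                    ≡⟨ e ⟩
    freeAt T (length r + suc i) + freeAt (spine n x) (suc i)
      ≡⟨ cong (freeAt T (length r + suc i) +_) (freeAt-spine-> n x (suc i) (NP.≰⇒> i≮n)) ⟩
    freeAt T (length r + suc i) + 0                     ≡⟨ NP.+-identityʳ _ ⟩
    freeAt T (length r + suc i)                         ≤⟨ few _ ⟩
    3 ∎

record Invariant (D : ℕ) (C : Config) (S : List (Id × ℕ)) : Set where
  field
    tree   : Tree
    shape  : C ↭ flatten id tree
    depth  : Depth≤ D tree
    few    : FewFree tree
    levels : map levelOf C ↭ S

open Invariant

Invariant-volume : ∀ {D C S} (I : Invariant D C S) → weight D S + freeVolume (freeAt (tree I)) D ≡ 4 ^ D
Invariant-volume {D} {C} {S} I =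
  trans (cong (_+ freeVolume (freeAt (tree I)) D) used) (volume-partition D (tree I) (depth I))
  where
  used : weight D S ≡ usedVolume D (tree I)
  used = trans (sym (weight-↭ D (levels I)))
           (trans (weight-↭ D (PermP.map⁺ levelOf (shape I)))
                  (flatten-weight D (tree I) id 0 D (depth I) (λ r → refl) refl))

insertSquare : ∀ {D C S} x l → Invariant D C S → l ≤ D → 4 ^ (D ∸ l) + weight D S ≤ 4 ^ D →
  ∃ λ q → Empty C q × length q ≡ l × Invariant D ((x , q) ∷ C) ((x , l) ∷ S)
insertSquare {D} {C} {S} x l I l≤D fits with lastNonzero (freeAt (tree I)) l
... | inj₁ zeros = ⊥-elim (NP.<⇒≱ tooSmall enough)
  where
  T = tree I
  enough : 4 ^ (D ∸ l) ≤ freeVolume (freeAt T) D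
  enough = NP.+-cancelʳ-≤ (weight D S) _ _
             (NP.≤-trans fits (NP.≤-reflexive (trans (sym (Invariant-volume I)) (NP.+-comm (weight D S) _))))
  tooSmall : freeVolume (freeAt T) D < 4 ^ (D ∸ l)
  tooSmall = subst (λ e → freeVolume (freeAt T) e < 4 ^ (D ∸ l)) (NP.m+[n∸m]≡n l≤D)
               (freeVolume-< (freeAt T) l zeros (few I) (D ∸ l))
... | inj₂ (k , k≤l , nonzero , gap) with freeLeafAt (tree I) k nonzero
... | r , refl , at = q , empty , length-q , record
  { tree = T' ; shape = shape' ; depth = depth' ; few = few' ; levels = levels' }
  where
  T = tree I
  n = l ∸ length r
  q = r ++ replicate n i₀
  T' = graft r (spine n x) T
  length-q : length q ≡ l
  length-q = trans (LP.length-++ r) (trans (cong (length r +_) (LP.length-replicate n)) (NP.m+[n∸m]≡n k≤l))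
  empty : Empty C q
  empty = PermP.All-resp-↭ (↭-sym (shape I))
            (All.map (Disjoint⇒Incomparable ∘ Disjoint-++ʳ (replicate n i₀)) (free-disjoint at))
  shape' : (x , q) ∷ C ↭ flatten id T'
  shape' = ↭-trans (Perm.prep (x , q) (shape I))
             (↭-sym (↭-trans (flatten-graft id (spine n x) at)
               (↭-reflexive (cong₂ _++_ (flatten-spine (r ++_) n x) (cong (flatten id) (graft-At at))))))
  depth' : Depth≤ D T'
  depth' = Depth≤-graft D (spine n x) at (depth I)
             (Depth≤-spine n x (D ∸ length r) (NP.∸-monoˡ-≤ (length r) l≤D))
  few' : FewFree T'
  few' = FewFree-graft-spine x n at (few I)
           (λ j r<j j≤ → gap j r<j (NP.≤-trans j≤ (NP.≤-reflexive (NP.m+[n∸m]≡n k≤l))))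
  levels' : map levelOf ((x , q) ∷ C) ↭ (x , l) ∷ S
  levels' = ↭-trans (Perm.prep (x , length q) (levels I)) (↭-reflexive (cong (λ l' → (x , l') ∷ S) length-q))

-- Removing an ℓ-square frees its leaf, which may create a
-- fourth free leaf at depth ℓ.  Then the four free leaves are gathered
-- below one parent by relocating the parent's non-free children into
-- the other free leaves, and merged into one free leaf at depth ℓ - 1,
-- which may in turn be a fourth one there; we repeat upwards.

freeAt-node-1 : ∀ i a b c d → child i (node a b c d) ≢ free → freeAt (node a b c d) 1 ≤ 3
freeAt-node-1 i a b c d notFree = oneChildTaken i a b c d (nonFree-root notFree)
  where
  nonFree-root : ∀ {t} → t ≢ free → freeAt t 0 ≡ 0
  nonFree-root {free} t≢free = ⊥-elim (t≢free refl)
  nonFree-root {square x} _ = refl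
  nonFree-root {node _ _ _ _} _ = refl
  oneChildTaken : ∀ i a b c d → freeAt (child i (node a b c d)) 0 ≡ 0 → freeAt (node a b c d) 1 ≤ 3
  oneChildTaken i₀ a b c d z rewrite z = NP.+-mono-≤ (freeAt-root b) (NP.+-mono-≤ (freeAt-root c) (freeAt-root d))
  oneChildTaken i₁ a b c d z rewrite z = NP.+-mono-≤ (freeAt-root a) (NP.+-mono-≤ (freeAt-root c) (freeAt-root d))
  oneChildTaken i₂ a b c d z rewrite z = NP.+-mono-≤ (freeAt-root a) (NP.+-mono-≤ (freeAt-root b) (freeAt-root d))
  oneChildTaken i₃ a b c d z rewrite z =
    NP.+-mono-≤ (freeAt-root a) (NP.+-mono-≤ (freeAt-root b) (NP.+-mono-≤ (freeAt-root c) (z≤n {0})))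

freeLeaf-outside : ∀ {P T Y} y k → At P T Y → freeAt (graft P (square y) T) k ≢ 0 →
  ∃ λ g → length g ≡ k × At g T free × Disjoint g P
freeLeaf-outside {P} {T} y k atP nonzero with freeLeafAt (graft P (square y) T) k nonzero
... | g , lg , atg = g , lg , At-graft-disjoint⁻ (square y) atP g#P atg , g#P
  where
  g#P : Disjoint g P
  g#P = leaves-disjoint atg (At-graft (square y) atP)

freeLeaf-beside : ∀ {P T} i a b c d → At P T (node a b c d) → child i (node a b c d) ≢ free →
  freeAt T (suc (length P)) ≡ 4 → ∃ λ g → length g ≡ suc (length P) × At g T free × Disjoint g P
freeLeaf-beside {P} {T} i a b c d atP notFree four =
  freeLeaf-outside 0 (suc (length P)) atP
    (λ z → absurd (subst (_≤ 3) (trans (sym (cong (_+ freeAt (node a b c d) 1) z)) count)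
                   (freeAt-node-1 i a b c d notFree)))
  where
  count : freeAt (graft P (square 0) T) (suc (length P)) + freeAt (node a b c d) 1 ≡ 4
  count = subst (λ k → freeAt (graft P (square 0) T) k + freeAt (node a b c d) 1 ≡ 4)
            (NP.+-comm (length P) 1)
            (trans (freeAt-graft-+ (square 0) atP 1)
              (trans (NP.+-identityʳ _) (trans (cong (freeAt T) (NP.+-comm (length P) 1)) four)))
  absurd : ¬ (4 ≤ 3)
  absurd (s≤s (s≤s (s≤s ())))

prefixRelocation : ∀ {a g} → Disjoint a g → length a ≡ length g → Relocation (a ++_) (g ++_)
prefixRelocation {a} {g} a#g la≡lg = record
  { apart     = λ r s → Disjoint-++ r s a#g
  ; separates = λ r s r#s → Disjoint-prefix g r#s
  ; sameLayer = λ r → trans (LP.length-++ a) (trans (cong (_+ length r) la≡lg) (sym (LP.length-++ g))) }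

relocateSubtree : ∀ D {C a g T X} → At a T X → At g T free → Disjoint a g → length a ≡ length g →
  Depth≤ D T → C ↭ flatten id T →
  ∃ λ C' → Moves C C' × C' ↭ flatten id (graft g X (graft a free T)) ×
    (∀ k → freeAt (graft g X (graft a free T)) k ≡ freeAt T k) × Depth≤ D (graft g X (graft a free T))
relocateSubtree D {C} {a} {g} {T} {X} atX atg a#g la≡lg bT C↭ =
  let (C' , moves , C'↭) = translate X (flatten id T₁) C (prefixRelocation a#g la≡lg)
                              (All.map (λ d s → Disjoint-++ʳ s d) (free-disjoint atg₁))
                              (↭-trans C↭ (flatten-split id atX))
  in C' , moves , ↭-trans C'↭ arrive , sameFree , depth'
  where
  T₁ = graft a free T
  atg₁ : At g T₁ free
  atg₁ = At-graft-disjoint a free atg (Disjoint-sym a#g)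
  arrive : flatten (g ++_) X ++ flatten id T₁ ↭ flatten id (graft g X T₁)
  arrive = ↭-sym (↭-trans (flatten-graft id X atg₁)
             (↭-reflexive (cong (flatten (g ++_) X ++_) (cong (flatten id) (graft-At atg₁)))))
  sameFree : ∀ k → freeAt (graft g X T₁) k ≡ freeAt T k
  sameFree k = NP.+-cancelʳ-≡ (shiftBy (length g) (freeAt free) k) _ _ (begin
    freeAt (graft g X T₁) k + shiftBy (length g) (freeAt free) k
      ≡⟨ freeAt-graft X atg₁ k ⟩
    freeAt T₁ k + shiftBy (length g) (freeAt X) k
      ≡⟨ cong (λ n → freeAt T₁ k + shiftBy n (freeAt X) k) (sym la≡lg) ⟩
    freeAt T₁ k + shiftBy (length a) (freeAt X) k
      ≡⟨ freeAt-graft free atX k ⟩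
    freeAt T k + shiftBy (length a) (freeAt free) k
      ≡⟨ cong (λ n → freeAt T k + shiftBy n (freeAt free) k) la≡lg ⟩
    freeAt T k + shiftBy (length g) (freeAt free) k ∎)
    where open Eq.≡-Reasoning
  depth' : Depth≤ D (graft g X T₁)
  depth' = Depth≤-graft D X atg₁ (Depth≤-graft D free atX bT tt)
             (subst (λ n → Depth≤ (D ∸ n) X) la≡lg (Depth≤-At D atX bT))

isFree? : (t : Tree) → Dec (t ≡ free)
isFree? free = yes refl
isFree? (square x) = no (λ ())
isFree? (node a b c d) = no (λ ())

gatherChild : ∀ D i {C P a b c d T} → At P T (node a b c d) → freeAt T (suc (length P)) ≡ 4 →
  Depth≤ D T → C ↭ flatten id T →
  ∃ λ T' → ∃ λ C' → Moves C C' × C' ↭ flatten id T' × At P T' (replaceChild i free (node a b c d)) ×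
    (∀ k → freeAt T' k ≡ freeAt T k) × Depth≤ D T'
gatherChild D i {C} {P} {a} {b} {c} {d} {T} atP four bT C↭ with isFree? (child i (node a b c d))
... | yes isFree =
  T , C , ε , C↭ , subst (At P T) (sym (replaceChild-child i free a b c d isFree)) atP , (λ k → refl) , bT
... | no notFree with freeLeaf-beside i a b c d atP notFree four
... | g , lg , atg , g#P with relocateSubtree D (At-++ atP (down here)) atg
                               (Disjoint-sym (Disjoint-++ʳ (i ∷ []) g#P))
                               (trans (LP.length-++ P) (trans (NP.+-comm (length P) 1) (sym lg))) bT C↭
... | C' , moves , C'↭ , sameFree , depth' =
  _ , C' , moves , C'↭ ,
  At-graft-disjoint g _ (At-graft-below (i ∷ []) free atP) (Disjoint-sym g#P) , sameFree , depth'

freeNode : Tree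
freeNode = node free free free free

gatherSiblings : ∀ D {C P a b c d T} → At P T (node a b c d) → freeAt T (suc (length P)) ≡ 4 →
  Depth≤ D T → C ↭ flatten id T →
  ∃ λ T' → ∃ λ C' → Moves C C' × C' ↭ flatten id T' × At P T' freeNode ×
    (∀ k → freeAt T' k ≡ freeAt T k) × Depth≤ D T'
gatherSiblings D {P = P} atP four bT C↭
  with gatherChild D i₀ atP four bT C↭
... | T₁ , C₁ , m₁ , C₁↭ , at₁ , e₁ , b₁
  with gatherChild D i₁ at₁ (trans (e₁ _) four) b₁ C₁↭
... | T₂ , C₂ , m₂ , C₂↭ , at₂ , e₂ , b₂
  with gatherChild D i₂ at₂ (trans (e₂ _) (trans (e₁ _) four)) b₂ C₂↭
... | T₃ , C₃ , m₃ , C₃↭ , at₃ , e₃ , b₃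
  with gatherChild D i₃ at₃ (trans (e₃ _) (trans (e₂ _) (trans (e₁ _) four))) b₃ C₃↭
... | T₄ , C₄ , m₄ , C₄↭ , at₄ , e₄ , b₄ =
  T₄ , C₄ , m₁ ◅◅ (m₂ ◅◅ (m₃ ◅◅ m₄)) , C₄↭ , at₄ ,
  (λ k → trans (e₄ k) (trans (e₃ k) (trans (e₂ k) (e₁ k)))) , b₄

AlmostFewFree : ℕ → Tree → Set
AlmostFewFree m T = (∀ k → k ≢ m → freeAt T k ≤ 3) × freeAt T m ≤ 4

merge-AlmostFewFree : ∀ {P T} → At P T freeNode →
  (∀ k → k ≢ suc (length P) → freeAt T k ≤ 3) → freeAt T (suc (length P)) ≡ 4 →
  AlmostFewFree (length P) (graft P free T)
merge-AlmostFewFree {P} {T} at few four = few' , atP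
  where
  T' = graft P free T
  n = length P
  counts : ∀ i → freeAt T' (n + i) + freeAt freeNode i ≡ freeAt T (n + i) + freeAt free i
  counts = freeAt-graft-+ free at
  few' : ∀ k → k ≢ n → freeAt T' k ≤ 3
  few' k k≢n with depth-split n k
  ... | inj₁ k<n = subst (_≤ 3) (sym (freeAt-graft-< free at k k<n))
                     (few k (λ k≡ → NP.<-irrefl k≡ (NP.<-trans k<n (NP.n<1+n n))))
  ... | inj₂ (zero , refl) = ⊥-elim (k≢n (NP.+-identityʳ n))
  ... | inj₂ (suc zero , refl) = subst (_≤ 3) (sym emptied) z≤n
    where
    emptied : freeAt T' (n + 1) ≡ 0
    emptied = NP.+-cancelʳ-≡ 4 _ 0
      (trans (counts 1) (trans (NP.+-identityʳ _) (trans (cong (freeAt T) (NP.+-comm n 1)) four)))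
  ... | inj₂ (suc (suc j) , refl) =
    subst (_≤ 3) (sym (NP.+-cancelʳ-≡ 0 _ _ (counts (suc (suc j)))))
      (few (n + suc (suc j)) (λ e → 2+j≢1 (NP.+-cancelˡ-≡ n (suc (suc j)) 1 (trans e (NP.+-comm 1 n)))))
    where
    2+j≢1 : suc (suc j) ≢ 1
    2+j≢1 ()
  atP : freeAt T' n ≤ 4
  atP = subst (λ k → freeAt T' k ≤ 4) (NP.+-identityʳ n)
          (NP.+-cancelʳ-≤ 0 _ _ (NP.≤-trans (NP.≤-reflexive (counts 0))
            (NP.+-monoˡ-≤ 1 (few (n + 0) (λ e → NP.<-irrefl (trans (sym (NP.+-identityʳ n)) e) (NP.n<1+n n))))))

mergeBelow : ∀ D {C P a b c d T} → At P T (node a b c d) →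
  (∀ k → k ≢ suc (length P) → freeAt T k ≤ 3) → freeAt T (suc (length P)) ≡ 4 →
  Depth≤ D T → C ↭ flatten id T →
  ∃ λ T' → ∃ λ C' → Moves C C' × C' ↭ flatten id T' × Depth≤ D T' × AlmostFewFree (length P) T'
mergeBelow D {P = P} atP few four bT C↭ with gatherSiblings D atP four bT C↭
... | T' , C' , moves , C'↭ , at' , same , b' =
  graft P free T' , C' , moves , ↭-trans C'↭ (flatten-split id at') , Depth≤-graft D free at' b' tt ,
  merge-AlmostFewFree at' (λ k k≢ → subst (_≤ 3) (sym (same k)) (few k k≢)) (trans (same _) four)

restore : ∀ D m {C T} → C ↭ flatten id T → Depth≤ D T → AlmostFewFree m T →
  ∃ λ T' → ∃ λ C' → Moves C C' × C' ↭ flatten id T' × Depth≤ D T' × FewFree T'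
restore D m {C} {T} C↭ bT (few , atm) with freeAt T m N.≤? 3
... | yes atm≤3 = T , C , ε , C↭ , bT , fewFree
  where
  fewFree : FewFree T
  fewFree k with k N.≟ m
  ... | yes refl = atm≤3
  ... | no k≢m = few k k≢m
restore D zero {C} {T} C↭ bT (few , atm) | no atm≰3 = ⊥-elim (atm≰3 (NP.≤-trans (freeAt-root T) (s≤s z≤n)))
restore D (suc m) {C} {T} C↭ bT (few , atm) | no atm≰3
  with freeLeafAt T (suc m) (λ z → atm≰3 (subst (_≤ 3) (sym z) z≤n))
... | i ∷ p , lg , atg with At-parent atg
... | P , lP , a , b , c , d , atP with trans lP (NP.suc-injective lg)
... | |P|≡m with mergeBelow D atP (subst (λ n → ∀ k → k ≢ suc n → freeAt T k ≤ 3) (sym |P|≡m) few)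
                   (subst (λ n → freeAt T (suc n) ≡ 4) (sym |P|≡m) (NP.≤-antisym atm (NP.≰⇒> atm≰3))) bT C↭
... | T₁ , C₁ , moves₁ , C₁↭ , b₁ , almost₁
  with restore D m C₁↭ b₁ (subst (λ n → AlmostFewFree n T₁) |P|≡m almost₁)
... | T' , C' , moves' , C'↭ , b' , few' = T' , C' , moves₁ ◅◅ moves' , C'↭ , b' , few'

vacate-AlmostFewFree : ∀ {p T x} → At p T (square x) → FewFree T → AlmostFewFree (length p) (graft p free T)
vacate-AlmostFewFree {p} {T} {x} at few = few' , atp
  where
  T' = graft p free T
  n = length p
  counts : ∀ i → freeAt T' (n + i) + freeAt (square x) i ≡ freeAt T (n + i) + freeAt free i
  counts = freeAt-graft-+ free at
  few' : ∀ k → k ≢ n → freeAt T' k ≤ 3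
  few' k k≢n with depth-split n k
  ... | inj₁ k<n = subst (_≤ 3) (sym (freeAt-graft-< free at k k<n)) (few k)
  ... | inj₂ (zero , refl) = ⊥-elim (k≢n (NP.+-identityʳ n))
  ... | inj₂ (suc i , refl) = subst (_≤ 3) (sym (NP.+-cancelʳ-≡ 0 _ _ (counts (suc i)))) (few _)
  atp : freeAt T' n ≤ 4
  atp = subst (λ k → freeAt T' k ≤ 4) (NP.+-identityʳ n)
          (NP.≤-trans (NP.≤-reflexive (trans (sym (NP.+-identityʳ _)) (counts 0))) (NP.+-monoˡ-≤ 1 (few (n + 0))))

moves-levels : ∀ {C C'} → Moves C C' → map levelOf C ↭ map levelOf C'
moves-levels ε = ↭-refl
moves-levels (move {x = x} C↭ _ same ◅ ms) =
  ↭-trans (↭-trans (PermP.map⁺ levelOf C↭) (↭-reflexive (cong (λ l → (x , l) ∷ _) (sym same))))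
          (moves-levels ms)

deleteSquare : ∀ {D C S S' x l} → Invariant D C S → S ↭ (x , l) ∷ S' →
  ∃ λ p → ∃ λ C₀ → ∃ λ C' → C ↭ (x , p) ∷ C₀ × Moves C₀ C' × Invariant D C' S'
deleteSquare {D} {C} {S} {S'} {x} {l} I S↭
  with MemP.∈-map⁻ levelOf (PermP.∈-resp-↭ (↭-sym (levels I)) (PermP.∈-resp-↭ (↭-sym S↭) (here refl)))
... | (x , p) , x∈C , refl with MemP.∈-∃++ x∈C
... | ys , zs , refl
  with restore D (length p) C₀↭ (Depth≤-graft D free at (depth I) tt) (vacate-AlmostFewFree at (few I))
  where
  C₀ = ys ++ zs
  at : At p (tree I) (square x)
  at = let (r , p≡r , at') = flatten-∈ id (tree I) (PermP.∈-resp-↭ (shape I) x∈C)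
       in subst (λ q → At q (tree I) (square x)) (sym p≡r) at'
  C₀↭ : C₀ ↭ flatten id (graft p free (tree I))
  C₀↭ = PermP.drop-∷ (↭-trans (↭-sym (PermP.shift (x , p) ys zs)) (↭-trans (shape I)
          (↭-trans (flatten-split id at)
            (↭-reflexive (cong (λ q → (x , q) ∷ flatten id (graft p free (tree I))) (LP.++-identityʳ p))))))
... | T' , C' , moves , C'↭ , b' , few' =
  p , ys ++ zs , C' , PermP.shift (x , p) ys zs , moves ,
  record { tree = T' ; shape = C'↭ ; depth = b' ; few = few' ; levels = levels' }
  where
  levels' : map levelOf C' ↭ S'
  levels' = ↭-trans (↭-sym (moves-levels moves))
              (PermP.drop-∷ (↭-trans (↭-sym (PermP.map⁺ levelOf (PermP.shift (x , p) ys zs)))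
                                     (↭-trans (levels I) S↭)))

-- Rational volumes.  The running volume sum of the requests is the
-- weight of the present squares times the unit 4^-D.

toℚ : ℕ → Q.ℚ
toℚ zero = Q.0ℚ
toℚ (suc n) = Q.1ℚ Q.+ toℚ n

toℚ-+ : ∀ m n → toℚ (m + n) ≡ toℚ m Q.+ toℚ n
toℚ-+ zero n = sym (QP.+-identityˡ (toℚ n))
toℚ-+ (suc m) n = trans (cong (Q.1ℚ Q.+_) (toℚ-+ m n)) (sym (QP.+-assoc Q.1ℚ (toℚ m) (toℚ n)))

toℚ-* : ∀ m n → toℚ (m * n) ≡ toℚ m Q.* toℚ n
toℚ-* zero n = sym (QP.*-zeroˡ (toℚ n))
toℚ-* (suc m) n = begin
  toℚ (n + m * n)                    ≡⟨ toℚ-+ n (m * n) ⟩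
  toℚ n Q.+ toℚ (m * n)              ≡⟨ cong₂ Q._+_ (sym (QP.*-identityˡ (toℚ n))) (toℚ-* m n) ⟩
  Q.1ℚ Q.* toℚ n Q.+ toℚ m Q.* toℚ n ≡⟨ sym (QP.*-distribʳ-+ (toℚ n) Q.1ℚ (toℚ m)) ⟩
  (Q.1ℚ Q.+ toℚ m) Q.* toℚ n ∎
  where open Eq.≡-Reasoning

toℚ-nonneg : ∀ k → Q.0ℚ Q.≤ toℚ k
toℚ-nonneg zero = QP.≤-refl
toℚ-nonneg (suc k) =
  QP.+-mono-≤ {Q.0ℚ} {Q.1ℚ} {Q.0ℚ} {toℚ k} (QP.<⇒≤ (QP.positive⁻¹ Q.1ℚ)) (toℚ-nonneg k)

toℚ-cancel-≤ : ∀ m n → toℚ m Q.≤ toℚ n → m ≤ n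
toℚ-cancel-≤ m n le with m N.≤? n
... | yes m≤n = m≤n
... | no m≰n = ⊥-elim (QP.<-irrefl refl (QP.<-≤-trans toℚn<toℚm le))
  where
  k = m ∸ suc n
  m≡n+1+k : m ≡ n + suc k
  m≡n+1+k = trans (sym (NP.m+[n∸m]≡n (NP.≰⇒> m≰n))) (sym (NP.+-suc n k))
  1+k-positive : Q.0ℚ Q.< toℚ (suc k)
  1+k-positive = QP.+-mono-<-≤ {Q.0ℚ} {Q.1ℚ} {Q.0ℚ} {toℚ k} (QP.positive⁻¹ Q.1ℚ) (toℚ-nonneg k)
  toℚn<toℚm : toℚ n Q.< toℚ m
  toℚn<toℚm = subst₂ Q._<_ (QP.+-identityʳ (toℚ n)) (trans (sym (toℚ-+ n (suc k))) (cong toℚ (sym m≡n+1+k)))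
                (QP.+-monoʳ-< (toℚ n) 1+k-positive)

quarterPow-positive : ∀ n → Q.Positive (quarterPow n)
quarterPow-positive zero = _
quarterPow-positive (suc n) = QP.pos*pos⇒pos (quarterPow n) {{quarterPow-positive n}} (ℤ.+ 1 Q./ 4)

quarterPow-+ : ∀ l j → quarterPow l ≡ quarterPow (l + j) Q.* toℚ (4 ^ j)
quarterPow-+ l zero =
  trans (sym (QP.*-identityʳ (quarterPow l))) (cong (Q._* Q.1ℚ) (cong quarterPow (sym (NP.+-identityʳ l))))
quarterPow-+ l (suc j) = trans (quarterPow-+ l j) (sym (begin
  quarterPow (l + suc j) Q.* toℚ (4 * 4 ^ j)
    ≡⟨ cong₂ Q._*_ (cong quarterPow (NP.+-suc l j)) (toℚ-* 4 (4 ^ j)) ⟩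
  (quarterPow (l + j) Q.* ¼) Q.* (toℚ 4 Q.* toℚ (4 ^ j))
    ≡⟨ QP.*-assoc (quarterPow (l + j)) ¼ (toℚ 4 Q.* toℚ (4 ^ j)) ⟩
  quarterPow (l + j) Q.* (¼ Q.* (toℚ 4 Q.* toℚ (4 ^ j)))
    ≡⟨ cong (quarterPow (l + j) Q.*_) (sym (QP.*-assoc ¼ (toℚ 4) (toℚ (4 ^ j)))) ⟩
  quarterPow (l + j) Q.* ((¼ Q.* toℚ 4) Q.* toℚ (4 ^ j))
    ≡⟨ cong (quarterPow (l + j) Q.*_) (QP.*-identityˡ (toℚ (4 ^ j))) ⟩
  quarterPow (l + j) Q.* toℚ (4 ^ j) ∎))
  where
  open Eq.≡-Reasoning
  ¼ = ℤ.+ 1 Q./ 4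

quarterPow-unit : ∀ D l → l ≤ D → quarterPow l ≡ toℚ (4 ^ (D ∸ l)) Q.* quarterPow D
quarterPow-unit D l l≤D = trans (quarterPow-+ l (D ∸ l))
  (trans (cong (λ e → quarterPow e Q.* toℚ (4 ^ (D ∸ l))) (NP.m+[n∸m]≡n l≤D)) (QP.*-comm (quarterPow D) _))

sum-insert : ∀ D l s w → s ≡ toℚ w Q.* quarterPow D → l ≤ D →
  s Q.+ quarterPow l ≡ toℚ (4 ^ (D ∸ l) + w) Q.* quarterPow D
sum-insert D l s w s≡ l≤D = begin
  s Q.+ quarterPow l         ≡⟨ cong₂ Q._+_ s≡ (quarterPow-unit D l l≤D) ⟩
  toℚ w Q.* u Q.+ toℚ M Q.* u ≡⟨ QP.+-comm (toℚ w Q.* u) (toℚ M Q.* u) ⟩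
  toℚ M Q.* u Q.+ toℚ w Q.* u ≡⟨ sym (QP.*-distribʳ-+ u (toℚ M) (toℚ w)) ⟩
  (toℚ M Q.+ toℚ w) Q.* u    ≡⟨ cong (Q._* u) (sym (toℚ-+ M w)) ⟩
  toℚ (M + w) Q.* u ∎
  where
  open Eq.≡-Reasoning
  u = quarterPow D
  M = 4 ^ (D ∸ l)

sum-delete : ∀ D l s w → s ≡ toℚ (4 ^ (D ∸ l) + w) Q.* quarterPow D → l ≤ D →
  s Q.+ Q.- quarterPow l ≡ toℚ w Q.* quarterPow D
sum-delete D l s w s≡ l≤D = begin
  s Q.+ Q.- q                ≡⟨ cong (Q._+ Q.- q) (trans s≡ (sym (sum-insert D l v w refl l≤D))) ⟩
  (v Q.+ q) Q.+ Q.- q        ≡⟨ QP.+-assoc v q (Q.- q) ⟩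
  v Q.+ (q Q.+ Q.- q)        ≡⟨ cong (v Q.+_) (QP.+-inverseʳ q) ⟩
  v Q.+ Q.0ℚ                 ≡⟨ QP.+-identityʳ v ⟩
  v ∎
  where
  open Eq.≡-Reasoning
  q = quarterPow l
  v = toℚ w Q.* quarterPow D

sum-bound : ∀ D s w → s Q.≤ Q.1ℚ → s ≡ toℚ w Q.* quarterPow D → w ≤ 4 ^ D
sum-bound D s w s≤1 s≡ =
  toℚ-cancel-≤ w (4 ^ D) (QP.*-cancelʳ-≤-pos (quarterPow D) {{quarterPow-positive D}}
    (subst₂ Q._≤_ s≡ (quarterPow-unit D 0 z≤n) s≤1))

level : Request → ℕ
level (insert _ l) = l
level (delete _ l) = l

maxLevel : List Request → ℕ
maxLevel [] = 0
maxLevel (r ∷ rs) = level r N.⊔ maxLevel rs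

maxLevel-bound : ∀ rs → All (λ r → level r ≤ maxLevel rs) rs
maxLevel-bound [] = []
maxLevel-bound (r ∷ rs) = NP.m≤m⊔n (level r) (maxLevel rs) ∷
  All.map (λ le → NP.≤-trans le (NP.m≤n⊔m (level r) (maxLevel rs))) (maxLevel-bound rs)

Invariant-empty : ∀ D → Invariant D emptyConfig []
Invariant-empty D = record { tree = free ; shape = ↭-refl ; depth = tt ; few = fewFree ; levels = ↭-refl }
  where
  fewFree : FewFree free
  fewFree zero = s≤s z≤n
  fewFree (suc k) = z≤n

-- Serve the requests one by one, keeping the invariant; s is the
-- running volume sum.  Insertions fit by validity and the volume
-- identity; deletions are always possible.
serve : ∀ D rs {C S s} → Invariant D C S → s ≡ toℚ (weight D S) Q.* quarterPow D →
  All (λ r → level r ≤ D) rs → WellFormed S rs → ValidFrom s rs → Fulfills C rs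
serve D [] I s≡ bounded wf valid = done
serve D (insert x l ∷ rs) {C} {S} {s} I s≡ (l≤D ∷ bounded) (_ , wf) (fits , valid) =
  let s'≡ = sum-insert D l s (weight D S) s≡ l≤D
      (q , empty , length-q , I') = insertSquare x l I l≤D (sum-bound D _ _ fits s'≡)
  in step (fulfillInsert ε empty length-q) (serve D rs I' s'≡ bounded wf valid)
serve D (delete x l ∷ rs) {C} {S} {s} I s≡ (l≤D ∷ bounded) (S' , S↭ , wf) (_ , valid) =
  let s≡' = trans s≡ (cong (λ w → toℚ w Q.* quarterPow D) (weight-↭ D S↭))
      s'≡ = sum-delete D l s (weight D S') s≡' l≤D
      (p , C₀ , C' , C↭ , moves , I') = deleteSquare I S↭
  in step (fulfillDelete C↭ moves) (serve D rs I' s'≡ bounded wf valid)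

corollary3 : (σ : List Request) →
             WellFormed [] σ →
             Valid σ →
             Fulfills emptyConfig σ
corollary3 σ wf valid =
  serve (maxLevel σ) σ (Invariant-empty (maxLevel σ)) (sym (QP.*-zeroˡ (quarterPow (maxLevel σ))))
        (maxLevel-bound σ) wf valid
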